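{- The variety of lower wBCK*-semilattices is arithmetical, i.e. congruence distributive and congruence permutable.
   Context: A lower wBCK*-semilattice is an algebra $(A,\wedge,\to,1)$ where $(A,\wedge)$ is a meet-semilattice with order $\le$ and greatest element $1$, such that for all $x,y,z$: $x\le y$ iff $x\to y=1$, and if $x\le y\to z$ then $y\le x\to z$. (This class is equationally definable.) -}

module Defs where

open import Level using (Level; _⊔_; suc)
open import Relation.Binary.PropositionalEquality using (_≡_)
open import Relation.Binary.Core using (Rel)
open import Relation.Binary.Structures using (IsEquivalence)
open import Data.Product using (Σ; _×_)
open import Data.Sum using (_⊎_)

record LowerWBCKStarSemilattice (a : Level) : Set (suc a) where
  infixr 7 _∧_
  infixr 5 _⇒_
  infix 4 _≤_
  field
    Carrier : Set a
    _∧_     : Carrier → Carrier → Carrier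
    _⇒_     : Carrier → Carrier → Carrier
    𝟙       : Carrier
    ∧-idem  : ∀ x → x ∧ x ≡ x
    ∧-comm  : ∀ x y → x ∧ y ≡ y ∧ x
    ∧-assoc : ∀ x y z → (x ∧ y) ∧ z ≡ x ∧ (y ∧ z)

  _≤_ : Carrier → Carrier → Set a
  x ≤ y = x ∧ y ≡ x

  field
    𝟙-top     : ∀ x → x ≤ 𝟙
    ≤⇒⇒≡𝟙     : ∀ {x y} → x ≤ y → x ⇒ y ≡ 𝟙
    ⇒≡𝟙⇒≤     : ∀ {x y} → x ⇒ y ≡ 𝟙 → x ≤ y
    exchange  : ∀ {x y z} → x ≤ y ⇒ z → y ≤ x ⇒ z

-- Congruences of an algebra (A, ∧, →, 1): equivalence relations compatible
-- with the basic operations (compatibility with the constant 1 is automatic).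
record Congruence {a : Level} (A : LowerWBCKStarSemilattice a) (ℓ : Level)
       : Set (a ⊔ suc ℓ) where
  open LowerWBCKStarSemilattice A
  field
    rel     : Rel Carrier ℓ
    isEquiv : IsEquivalence rel
    ∧-cong  : ∀ {x x′ y y′} → rel x x′ → rel y y′ → rel (x ∧ y) (x′ ∧ y′)
    ⇒-cong  : ∀ {x x′ y y′} → rel x x′ → rel y y′ → rel (x ⇒ y) (x′ ⇒ y′)

open Congruence public

module _ {a : Level} {A : LowerWBCKStarSemilattice a} where
  open LowerWBCKStarSemilattice A

  _∩_ : ∀ {ℓ ℓ′} → Rel Carrier ℓ → Rel Carrier ℓ′ → Rel Carrier (ℓ ⊔ ℓ′)
  (R ∩ S) x y = R x y × S x y

  data Join {ℓ ℓ′} (R : Rel Carrier ℓ) (S : Rel Carrier ℓ′) : Rel Carrier (a ⊔ ℓ ⊔ ℓ′) where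
    step  : ∀ {x y} → R x y ⊎ S x y → Join R S x y
    trans : ∀ {x y z} → Join R S x y → Join R S y z → Join R S x z

  _∘ʳ_ : ∀ {ℓ} → Rel Carrier ℓ → Rel Carrier ℓ → Rel Carrier (a ⊔ ℓ)
  (R ∘ʳ S) x z = Σ Carrier λ y → R x y × S y z

  _⊆ʳ_ : ∀ {ℓ ℓ′} → Rel Carrier ℓ → Rel Carrier ℓ′ → Set (a ⊔ ℓ ⊔ ℓ′)
  R ⊆ʳ S = ∀ {x y} → R x y → S x y

CongruenceDistributive : ∀ {a} (A : LowerWBCKStarSemilattice a) (ℓ : Level)
                       → Set (a ⊔ suc ℓ)
CongruenceDistributive A ℓ =
  ∀ (θ φ ψ : Congruence A ℓ) →
    _⊆ʳ_ {A = A} (_∩_ {A = A} (rel θ) (Join {A = A} (rel φ) (rel ψ)))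
       (Join {A = A} (_∩_ {A = A} (rel θ) (rel φ)) (_∩_ {A = A} (rel θ) (rel ψ)))
  × _⊆ʳ_ {A = A} (Join {A = A} (_∩_ {A = A} (rel θ) (rel φ)) (_∩_ {A = A} (rel θ) (rel ψ)))
       (_∩_ {A = A} (rel θ) (Join {A = A} (rel φ) (rel ψ)))

CongruencePermutable : ∀ {a} (A : LowerWBCKStarSemilattice a) (ℓ : Level)
                     → Set (a ⊔ suc ℓ)
CongruencePermutable A ℓ =
  ∀ (θ φ : Congruence A ℓ) →
    _⊆ʳ_ {A = A} (_∘ʳ_ {A = A} (rel θ) (rel φ)) (_∘ʳ_ {A = A} (rel φ) (rel θ))

Arithmetical : ∀ {a} (A : LowerWBCKStarSemilattice a) (ℓ : Level) → Set (a ⊔ suc ℓ)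
Arithmetical A ℓ = CongruenceDistributive A ℓ × CongruencePermutable A ℓ

-- The proof goes through a Pixley term
--   p(x,y,z) = ((x → y) → z) ∧ ((z → y) → x) ∧ ((x → z) → z),
-- which satisfies p(x,y,y) = x, p(y,y,x) = x and p(x,y,x) = x.
-- 1. A few order facts valid in every lower wBCK*-semilattice
--    (x ≤ y → x, x ≤ (x → y) → y, 1 → x = x) give these three identities.
-- 2. From any Pixley term t one obtains the majority term
--    m(x,y,z) = t(x, t(x,y,z), z)   (purely equational, on any set).
-- 3. Both are term operations, so every congruence preserves them.
-- 4. Classical Mal'cev conditions: a Mal'cev term preserved by all
--    congruences makes congruences permute, and a majority term preserved
--    by all congruences makes the congruence lattice distributive.

module Submission where

open import Level using (Level)
open import Defs
open import Data.Product using (_,_)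
open import Data.Sum using (inj₁; inj₂)
open import Relation.Binary.Core using (Rel)
open import Relation.Binary.PropositionalEquality
  using (_≡_; sym; cong; subst; subst₂; module ≡-Reasoning)
open import Relation.Binary.Structures using (IsEquivalence)

module WBCKOrder {a} (A : LowerWBCKStarSemilattice a) where
  open LowerWBCKStarSemilattice A
  open ≡-Reasoning

  ≤-antisym : ∀ {x y} → x ≤ y → y ≤ x → x ≡ y
  ≤-antisym {x} {y} x≤y y≤x = begin
    x      ≡⟨ sym x≤y ⟩
    x ∧ y  ≡⟨ ∧-comm x y ⟩
    y ∧ x  ≡⟨ y≤x ⟩
    y      ∎

  ≤-∧ : ∀ {x u v} → x ≤ u → x ≤ v → x ≤ u ∧ v
  ≤-∧ {x} {u} {v} x≤u x≤v = begin
    x ∧ (u ∧ v)  ≡⟨ sym (∧-assoc x u v) ⟩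
    (x ∧ u) ∧ v  ≡⟨ cong (_∧ v) x≤u ⟩
    x ∧ v        ≡⟨ x≤v ⟩
    x            ∎

  ≤⇒∧-absorbˡ : ∀ {x u} → x ≤ u → u ∧ x ≡ x
  ≤⇒∧-absorbˡ {x} {u} x≤u = begin
    u ∧ x  ≡⟨ ∧-comm u x ⟩
    x ∧ u  ≡⟨ x≤u ⟩
    x      ∎

  ⇒-refl : ∀ x → x ⇒ x ≡ 𝟙
  ⇒-refl x = ≤⇒⇒≡𝟙 (∧-idem x)

  ≤-K : ∀ x y → x ≤ y ⇒ x
  ≤-K x y = exchange (subst (y ≤_) (sym (⇒-refl x)) (𝟙-top y))

  ≤-MP : ∀ x y → x ≤ (x ⇒ y) ⇒ y
  ≤-MP x y = exchange (∧-idem (x ⇒ y))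

  -- 1 is a left unit for →: x ≤ 1 → x by K, and 1 ≤ (1 → x) → x by MP.
  𝟙⇒ : ∀ x → 𝟙 ⇒ x ≡ x
  𝟙⇒ x = ≤-antisym (⇒≡𝟙⇒≤ 𝟙⇒x⇒x≡𝟙) (≤-K x 𝟙)
    where
    𝟙⇒x⇒x≡𝟙 : (𝟙 ⇒ x) ⇒ x ≡ 𝟙
    𝟙⇒x⇒x≡𝟙 = ≤-antisym (𝟙-top _) (≤-MP 𝟙 x)

module WBCKPixley {a} (A : LowerWBCKStarSemilattice a) where
  open LowerWBCKStarSemilattice A
  open WBCKOrder A
  open ≡-Reasoning

  pixley : Carrier → Carrier → Carrier → Carrier
  pixley x y z = ((x ⇒ y) ⇒ z) ∧ (((z ⇒ y) ⇒ x) ∧ ((x ⇒ z) ⇒ z))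

  -- p(x,y,y) = c ∧ (x ∧ c) with c = (x → y) → y ≥ x.
  pixley-xyy : ∀ x y → pixley x y y ≡ x
  pixley-xyy x y rewrite ⇒-refl y | 𝟙⇒ x = begin
    c ∧ (x ∧ c)  ≡⟨ cong (c ∧_) (≤-MP x y) ⟩
    c ∧ x        ≡⟨ ≤⇒∧-absorbˡ (≤-MP x y) ⟩
    x            ∎
    where c = (x ⇒ y) ⇒ y

  -- p(y,y,x) = x ∧ (((x → y) → y) ∧ ((y → x) → x)), both factors ≥ x.
  pixley-yyx : ∀ x y → pixley y y x ≡ x
  pixley-yyx x y rewrite ⇒-refl y | 𝟙⇒ x = ≤-∧ (≤-MP x y) (≤-K x (y ⇒ x))

  -- p(x,y,x) = c ∧ (c ∧ x) with c = (x → y) → x ≥ x.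
  pixley-xyx : ∀ x y → pixley x y x ≡ x
  pixley-xyx x y rewrite ⇒-refl x | 𝟙⇒ x = begin
    c ∧ (c ∧ x)  ≡⟨ sym (∧-assoc c c x) ⟩
    (c ∧ c) ∧ x  ≡⟨ cong (_∧ x) (∧-idem c) ⟩
    c ∧ x        ≡⟨ ≤⇒∧-absorbˡ (≤-K x (x ⇒ y)) ⟩
    x            ∎
    where c = (x ⇒ y) ⇒ x

  pixley-cong : ∀ {ℓ} (θ : Congruence A ℓ) {x x′ y y′ z z′}
    → rel θ x x′ → rel θ y y′ → rel θ z z′
    → rel θ (pixley x y z) (pixley x′ y′ z′)
  pixley-cong θ x≈ y≈ z≈ =
    ∧-cong θ (⇒-cong θ (⇒-cong θ x≈ y≈) z≈)
      (∧-cong θ (⇒-cong θ (⇒-cong θ z≈ y≈) x≈) (⇒-cong θ (⇒-cong θ x≈ z≈) z≈))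

module PixleyToMajority {a} {X : Set a} (t : X → X → X → X)
  (t-xyy : ∀ x y → t x y y ≡ x)
  (t-yyx : ∀ x y → t y y x ≡ x)
  (t-xyx : ∀ x y → t x y x ≡ x) where

  majority : X → X → X → X
  majority x y z = t x (t x y z) z

  majority-xxy : ∀ x y → majority x x y ≡ x
  majority-xxy x y rewrite t-yyx y x = t-xyy x y

  majority-xyy : ∀ x y → majority x y y ≡ y
  majority-xyy x y rewrite t-xyy x y = t-yyx y x

  majority-xyx : ∀ x y → majority x y x ≡ x
  majority-xyx x y rewrite t-xyx x y = t-xyx x x

module MalcevConditions {a} (A : LowerWBCKStarSemilattice a) where
  open LowerWBCKStarSemilattice A using (Carrier)

  Preserves₃ : ∀ {ℓ} → (Carrier → Carrier → Carrier → Carrier) → Rel Carrier ℓ → Set _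
  Preserves₃ t R = ∀ {x x′ y y′ z z′} → R x x′ → R y y′ → R z z′ → R (t x y z) (t x′ y′ z′)

  -- A Mal'cev term t (t x y y = x, t y y z = z) turns x θ y φ z into
  -- x φ t(x,y,z) θ z.
  malcev⇒permutable : ∀ {ℓ} (t : Carrier → Carrier → Carrier → Carrier)
    → (∀ x y → t x y y ≡ x) → (∀ x y → t y y x ≡ x)
    → (∀ (θ : Congruence A ℓ) → Preserves₃ t (rel θ))
    → CongruencePermutable A ℓ
  malcev⇒permutable t t-xyy t-yyx preserves θ φ {x} {z} (y , xθy , yφz) =
    t x y z , xφw , wθz
    where
    module θ = IsEquivalence (isEquiv θ)
    module φ = IsEquivalence (isEquiv φ)
    xφw : rel φ x (t x y z)
    xφw = subst (λ u → rel φ u (t x y z)) (t-xyy x z)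
                (preserves φ φ.refl (φ.sym yφz) φ.refl)
    wθz : rel θ (t x y z) z
    wθz = subst (rel θ (t x y z)) (t-yyx z y) (preserves θ xθy θ.refl θ.refl)

  -- The inclusion (θ ∧ φ) ∨ (θ ∧ ψ) ⊆ θ ∧ (φ ∨ ψ) holds in every lattice of
  -- equivalence relations; only transitivity of θ is needed.
  join-of-meets-⊆ : ∀ {ℓ} (θ φ ψ : Congruence A ℓ) {x y}
    → Join {A = A} (_∩_ {A = A} (rel θ) (rel φ)) (_∩_ {A = A} (rel θ) (rel ψ)) x y
    → _∩_ {A = A} (rel θ) (Join {A = A} (rel φ) (rel ψ)) x y
  join-of-meets-⊆ θ φ ψ (step (inj₁ (xθy , xφy))) = xθy , step (inj₁ xφy)
  join-of-meets-⊆ θ φ ψ (step (inj₂ (xθy , xψy))) = xθy , step (inj₂ xψy)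
  join-of-meets-⊆ θ φ ψ (trans j k) with join-of-meets-⊆ θ φ ψ j | join-of-meets-⊆ θ φ ψ k
  ... | θj , j′ | θk , k′ = IsEquivalence.trans (isEquiv θ) θj θk , trans j′ k′

  -- A majority term m gives the other inclusion: if x θ y and u₀ … uₙ is a
  -- φ/ψ-chain from x to y, then m(x,uᵢ,y) is a chain from m(x,x,y) = x to
  -- m(x,y,y) = y whose links are also in θ, since m(x,u,y) θ m(x,u,x) = x.
  majority⇒distributive : ∀ {ℓ} (m : Carrier → Carrier → Carrier → Carrier)
    → (∀ x y → m x x y ≡ x) → (∀ x y → m x y y ≡ y) → (∀ x y → m x y x ≡ x)
    → (∀ (θ : Congruence A ℓ) → Preserves₃ m (rel θ))
    → CongruenceDistributive A ℓ
  majority⇒distributive {ℓ} m m-xxy m-xyy m-xyx preserves θ φ ψ =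
    meet-of-join-⊆ , join-of-meets-⊆ θ φ ψ
    where
    module θ = IsEquivalence (isEquiv θ)

    collapses : ∀ {x y} u → rel θ x y → rel θ (m x u y) x
    collapses {x} {y} u xθy =
      subst (rel θ (m x u y)) (m-xyx x u) (preserves θ θ.refl θ.refl (θ.sym xθy))

    link : ∀ (σ : Congruence A ℓ) {x y u v} → rel θ x y → rel σ u v
      → _∩_ {A = A} (rel θ) (rel σ) (m x u y) (m x v y)
    link σ {u = u} {v} xθy uσv =
      θ.trans (collapses u xθy) (θ.sym (collapses v xθy))
      , preserves σ σ.refl uσv σ.refl
      where module σ = IsEquivalence (isEquiv σ)

    chain : ∀ {x y u v} → rel θ x y → Join {A = A} (rel φ) (rel ψ) u v
      → Join {A = A} (_∩_ {A = A} (rel θ) (rel φ)) (_∩_ {A = A} (rel θ) (rel ψ))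
             (m x u y) (m x v y)
    chain xθy (step (inj₁ uφv)) = step (inj₁ (link φ xθy uφv))
    chain xθy (step (inj₂ uψv)) = step (inj₂ (link ψ xθy uψv))
    chain xθy (trans j k) = trans (chain xθy j) (chain xθy k)

    meet-of-join-⊆ : ∀ {x y}
      → _∩_ {A = A} (rel θ) (Join {A = A} (rel φ) (rel ψ)) x y
      → Join {A = A} (_∩_ {A = A} (rel θ) (rel φ)) (_∩_ {A = A} (rel θ) (rel ψ)) x y
    meet-of-join-⊆ {x} {y} (xθy , j) =
      subst₂ (Join {A = A} _ _) (m-xxy x y) (m-xyy x y) (chain xθy j)

theorem5p4 : ∀ {a ℓ : Level} (A : LowerWBCKStarSemilattice a) → Arithmetical A ℓ
theorem5p4 A =
  majority⇒distributive majority majority-xxy majority-xyy majority-xyx majority-cong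
  , malcev⇒permutable pixley pixley-xyy pixley-yyx pixley-cong
  where
  open WBCKPixley A
  open PixleyToMajority pixley pixley-xyy pixley-yyx pixley-xyx
  open MalcevConditions A

  majority-cong : ∀ {ℓ} (θ : Congruence A ℓ) → Preserves₃ majority (rel θ)
  majority-cong θ x≈ y≈ z≈ = pixley-cong θ x≈ (pixley-cong θ x≈ y≈ z≈) z≈
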